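{- Let $\mathbf{X}\in\mathcal{C}$. Then every extension of $\mathbf{X}$ in $\mathcal{P}_2$ embeds into every extension of $\mathbf{S}(2)$.
   Context: $\mathbf{S}(2)$ is the tournament on the points of the unit circle of $\mathbb{C}$ with rational argument, with arc $x\to y$ iff $0<\arg(y/x)<\pi$; $\mathcal{C}$ is the class of finite tournaments isomorphic to induced subtournaments of $\mathbf{S}(2)$. $\mathcal{P}_2$ is the class of finite structures $(A,<,P_1,P_2)$ with $<$ a linear order on $A$ and $P_1,P_2$ disjoint with union $A$. For any (finite or infinite) structure $(A,<,P_1,P_2)$ of this kind, $p(A,<,P_1,P_2)$ is the tournament on $A$ with arc $a\to b$ iff ($a,b$ in the same part and $a<b$) or ($a,b$ in different parts and $b<a$); an extension of a tournament $\mathbf{X}$ with vertex set $X$ is a structure $(X,<,P_1,P_2)$ with $p(X,<,P_1,P_2)=\mathbf{X}$. An embedding between such structures is an order-preserving injection $f$ with $a\in P_i\iff f(a)\in P_i'$ for $i=1,2$. -}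

module Defs where

open import Level using (0ℓ)
open import Data.Nat as ℕ using (ℕ; zero; suc)
open import Data.Integer as ℤ using (ℤ)
open import Data.Rational using (ℚ; _/_; _+_; _-_; _*_; _<_; 0ℚ)
open import Data.Fin using (Fin)
open import Data.Product using (Σ; ∃; _×_)
open import Data.Sum using (_⊎_)
open import Relation.Nullary using (¬_)
open import Relation.Binary using (Rel; IsStrictTotalOrder)
open import Relation.Binary.PropositionalEquality using (_≡_)
open import Function.Bundles using (_⇔_)
open import Function.Definitions using (Injective)

-- π as a rational cut, via the Leibniz series
-- π = 4 (1 - 1/3 + 1/5 - ...).  leibniz n is the n-th partial sum
-- (times 4); even-indexed sums are lower bounds, odd-indexed ones upper
-- bounds, and both converge to π.

sgn : ℕ → ℤ
sgn zero    = ℤ.+ 1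
sgn (suc k) = ℤ.- sgn k

leibniz : ℕ → ℚ
leibniz zero    = 0ℚ
leibniz (suc k) = leibniz k + (ℤ.+ 4 ℤ.* sgn k) / suc (k ℕ.+ k)

ι : ℤ → ℚ
ι m = m / 1

_<π·_ : ℚ → ℤ → Set
r <π· m = ∃ λ n → (r < ι m * leibniz (n ℕ.+ n)) × (r < ι m * leibniz (suc (n ℕ.+ n)))

_π·<_ : ℤ → ℚ → Set
m π·< r = ∃ λ n → (ι m * leibniz (n ℕ.+ n) < r) × (ι m * leibniz (suc (n ℕ.+ n)) < r)

-- Points of the unit circle with rational argument are e^{iq},
-- q ∈ ℚ; distinct rationals give distinct points (2π is irrational),
-- so the vertex set is ℚ.  Arc e^{iq} → e^{iq'} iff 0 < arg(e^{i(q'-q)}) < π,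
-- i.e. iff 2kπ < q' - q < (2k+1)π for some integer k.

S2Arc : ℚ → ℚ → Set
S2Arc q q' = ∃ λ (k : ℤ) → ((ℤ.+ 2 ℤ.* k) π·< (q' - q)) × ((q' - q) <π· (ℤ.+ 2 ℤ.* k ℤ.+ ℤ.+ 1))

IsTournament : {V : Set} → Rel V 0ℓ → Set
IsTournament {V} arc =
  (∀ x → ¬ arc x x) ×
  (∀ x y → ¬ (arc x y × arc y x)) ×
  (∀ x y → ¬ x ≡ y → arc x y ⊎ arc y x)

InC : (n : ℕ) → Rel (Fin n) 0ℓ → Set
InC n arc = IsTournament arc ×
  Σ (Fin n → ℚ) λ g → Injective _≡_ _≡_ g × (∀ a b → arc a b ⇔ S2Arc (g a) (g b))

-- Structures (A, <, P₁, P₂): a strict linear order plus a partition of A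
-- into two parts, encoded as a colouring A → Fin 2
-- (P₁ = colour 0, P₂ = colour 1).

pArc : {A : Set} → Rel A 0ℓ → (A → Fin 2) → Rel A 0ℓ
pArc _<'_ col a b = (col a ≡ col b × a <' b) ⊎ (¬ col a ≡ col b × b <' a)

IsExtension : {A : Set} → Rel A 0ℓ → Rel A 0ℓ → (A → Fin 2) → Set
IsExtension arc _<'_ col =
  IsStrictTotalOrder _≡_ _<'_ × (∀ a b → arc a b ⇔ pArc _<'_ col a b)

Embeds : {A B : Set} → Rel A 0ℓ → (A → Fin 2) → Rel B 0ℓ → (B → Fin 2) → Set
Embeds {A} {B} _<₁_ col₁ _<₂_ col₂ =
  Σ (A → B) λ f → Injective _≡_ _≡_ f ×
    (∀ a b → a <₁ b → f a <₂ f b) × (∀ a → col₂ (f a) ≡ col₁ a)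

module Submission where

-- In an extension of S(2) (vertex e^{iq} identified with q ∈ ℚ) pick u such that u and u + 1
-- have the same colour: among 0, 1, 2 the arcs 0 → 1 → 2 and 0 → 2 form a transitive triangle,
-- and a transitive triangle whose ends share a colour is monochromatic.  Then the near window
-- u + (0,1) is monochromatic, while the far window u + π + (0,1) has the other colour, since
-- otherwise u → u + 1 → u + π + s → u would be a monochromatic 3-cycle.  On the union of the two
-- windows the linear order is the order of the offset in (0,1), whichever window a point is in.
-- A finite structure therefore embeds by sending its i-th element to u + (i+1)/(n+1), moved to
-- the far window when its colour is not that of u.  As π is irrational it is replaced by consecutive Leibniz partial
-- sums L < π < U with U - L < 1/(n+1).

open import Defs
open import Level using (0ℓ)
open import Data.Nat using (ℕ)
open import Data.Fin using (Fin)
open import Data.Rational using (ℚ)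
open import Relation.Binary using (Rel)

open import Data.Nat as ℕ using (zero; suc)
import Data.Nat.Properties as ℕ
open import Data.Nat.Tactic.RingSolver using (solve-∀)
open import Data.Integer as ℤ using (ℤ)
import Data.Integer.Properties as ℤ
import Data.Integer.Solver as ℤ-Solver
open import Data.Rational using (0ℚ; 1ℚ; _+_; _-_; -_; _*_; _/_; _<_; _≤_; toℚᵘ; _<?_)
open import Data.Rational.Properties
import Data.Rational.Unnormalised as ℚᵘ
import Data.Rational.Unnormalised.Properties as ℚᵘ
open import Data.Rational.Solver using (module +-*-Solver)
open import Data.Fin as Fin using (zero; suc)
import Data.Fin.Properties as Fin
open import Data.Fin.Subset using (Subset; _∈_; _∉_; ∣_∣)
open import Data.Fin.Subset.Properties using (p⊂q⇒∣p∣<∣q∣; ∣⊤∣≡n; ∈⊤)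
open import Data.Vec using (tabulate)
open import Data.Vec.Properties using (lookup∘tabulate; lookup⇒[]=; []=⇒lookup)
open import Data.Product using (∃; _×_; _,_; proj₁; proj₂)
open import Data.Sum using (inj₁; inj₂)
open import Function.Base using (_∘_)
open import Function.Bundles using (Equivalence)
open import Function.Definitions using (Injective)
open import Relation.Binary using (IsStrictTotalOrder; Irreflexive; tri<; tri≈; tri>)
open import Relation.Nullary using (Dec; does; yes; no; contradiction)
open import Relation.Nullary.Decidable using (True; toWitness; from-yes; dec-true)
open import Relation.Binary.PropositionalEquality

open +-*-Solver

/-<-cross : ∀ (a b c d : ℕ) → a ℕ.* suc d ℕ.< b ℕ.* suc c → ℤ.+ a / suc c < ℤ.+ b / suc d
/-<-cross a b c d ad<bc = toℚᵘ-cancel-<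
  (ℚᵘ.<-respʳ-≃ (ℚᵘ.≃-sym (toℚᵘ-fromℚᵘ (ℚᵘ.mkℚᵘ (ℤ.+ b) d)))
  (ℚᵘ.<-respˡ-≃ (ℚᵘ.≃-sym (toℚᵘ-fromℚᵘ (ℚᵘ.mkℚᵘ (ℤ.+ a) c)))
  (ℚᵘ.*<* (subst₂ ℤ._<_ (ℤ.pos-* a (suc d)) (ℤ.pos-* b (suc c)) (ℤ.+<+ ad<bc)))))

/-≤-cross : ∀ (a b c d : ℕ) → a ℕ.* suc d ℕ.≤ b ℕ.* suc c → ℤ.+ a / suc c ≤ ℤ.+ b / suc d
/-≤-cross a b c d ad≤bc = toℚᵘ-cancel-≤
  (ℚᵘ.≤-respʳ-≃ (ℚᵘ.≃-sym (toℚᵘ-fromℚᵘ (ℚᵘ.mkℚᵘ (ℤ.+ b) d)))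
  (ℚᵘ.≤-respˡ-≃ (ℚᵘ.≃-sym (toℚᵘ-fromℚᵘ (ℚᵘ.mkℚᵘ (ℤ.+ a) c)))
  (ℚᵘ.*≤* (subst₂ ℤ._≤_ (ℤ.pos-* a (suc d)) (ℤ.pos-* b (suc c)) (ℤ.+≤+ ad≤bc)))))

/-distribʳ-+ : ∀ (a b : ℤ) (c : ℕ) → (a ℤ.+ b) / suc c ≡ a / suc c + b / suc c
/-distribʳ-+ a b c = toℚᵘ-injective (begin-equality
  toℚᵘ ((a ℤ.+ b) / suc c)                 ≃⟨ toℚᵘ-fromℚᵘ (ℚᵘ.mkℚᵘ (a ℤ.+ b) c) ⟩
  ℚᵘ.mkℚᵘ (a ℤ.+ b) c                      ≃⟨ ℚᵘ.*≡* cross ⟩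
  ℚᵘ.mkℚᵘ a c ℚᵘ.+ ℚᵘ.mkℚᵘ b c             ≃⟨ ℚᵘ.+-cong (ℚᵘ.≃-sym (toℚᵘ-fromℚᵘ (ℚᵘ.mkℚᵘ a c)))
                                                          (ℚᵘ.≃-sym (toℚᵘ-fromℚᵘ (ℚᵘ.mkℚᵘ b c))) ⟩
  toℚᵘ (a / suc c) ℚᵘ.+ toℚᵘ (b / suc c)   ≃⟨ ℚᵘ.≃-sym (toℚᵘ-homo-+ (a / suc c) (b / suc c)) ⟩
  toℚᵘ (a / suc c + b / suc c)             ∎)
  where
  open ℚᵘ.≤-Reasoning
  open ℤ-Solver.+-*-Solver renaming (solve to ℤ-solve; _:+_ to _⊕_; _:*_ to _⊗_; _:=_ to _≐_)
  C = ℤ.+ suc c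
  cross : (a ℤ.+ b) ℤ.* ℤ.+ (suc c ℕ.* suc c) ≡ (a ℤ.* C ℤ.+ b ℤ.* C) ℤ.* C
  cross rewrite ℤ.pos-* (suc c) (suc c) =
    ℤ-solve 3 (λ a b z → (a ⊕ b) ⊗ (z ⊗ z) ≐ (a ⊗ z ⊕ b ⊗ z) ⊗ z) refl a b C

p<q⇒0<q-p : ∀ {p q} → p < q → 0ℚ < q - p
p<q⇒0<q-p {p} {q} p<q = subst (_< q - p) (+-inverseʳ p) (+-monoˡ-< (- p) p<q)

q<p+r⇒q-p<r : ∀ {p q r} → q < p + r → q - p < r
q<p+r⇒q-p<r {p} {q} {r} q<p+r =
  subst (q - p <_) (solve 2 (λ p r → p :+ r :- p := r) refl p r) (+-monoˡ-< (- p) q<p+r)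

p+q<r⇒q<r-p : ∀ {p q r} → p + q < r → q < r - p
p+q<r⇒q<r-p {p} {q} {r} p+q<r =
  subst (_< r - p) (solve 2 (λ p q → p :+ q :- p := q) refl p q) (+-monoˡ-< (- p) p+q<r)

p<p+q : ∀ p {q} → 0ℚ < q → p < p + q
p<p+q p {q} 0<q = subst (_< p + q) (+-identityʳ p) (+-monoʳ-< p 0<q)

p<r⇒p<q+r : ∀ {p q r} → p < r → 0ℚ ≤ q → p < q + r
p<r⇒p<q+r {p} {q} {r} p<r 0≤q =
  <-≤-trans p<r (subst (_≤ q + r) (+-identityˡ r) (+-monoˡ-≤ r 0≤q))

two : ℚ
two = 1ℚ + 1ℚ

-- lower N < π < upper N, two consecutive partial sums at distance gap N = 4/(4N+1).
lower upper gap : ℕ → ℚ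
lower N = leibniz (N ℕ.+ N)
upper N = leibniz (suc (N ℕ.+ N))
gap N = ℤ.+ 4 / suc ((N ℕ.+ N) ℕ.+ (N ℕ.+ N))

sgn-even : ∀ N → sgn (N ℕ.+ N) ≡ ℤ.+ 1
sgn-even zero    = refl
sgn-even (suc N) rewrite ℕ.+-suc N N = trans (ℤ.neg-involutive (sgn (N ℕ.+ N))) (sgn-even N)

upper≡lower+gap : ∀ N → upper N ≡ lower N + gap N
upper≡lower+gap N rewrite sgn-even N = refl

lower-suc : ∀ N → lower (suc N) ≡ upper N - ℤ.+ 4 / suc (suc (N ℕ.+ N) ℕ.+ suc (N ℕ.+ N))
lower-suc N rewrite ℕ.+-suc N N | sgn-even N = refl

gap-pos : ∀ N → 0ℚ < gap N
gap-pos N = /-<-cross 0 4 0 ((N ℕ.+ N) ℕ.+ (N ℕ.+ N)) (ℕ.s≤s ℕ.z≤n)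

gap<1/suc : ∀ N → gap (suc N) < ℤ.+ 1 / suc N
gap<1/suc N = /-<-cross 4 1 c N
  (subst₂ ℕ._<_ (sym (4*suc≡c N)) (sym (ℕ.*-identityˡ (suc c))) (ℕ.n<1+n c))
  where
  c = (suc N ℕ.+ suc N) ℕ.+ (suc N ℕ.+ suc N)
  4*suc≡c : ∀ N → 4 ℕ.* suc N ≡ (suc N ℕ.+ suc N) ℕ.+ (suc N ℕ.+ suc N)
  4*suc≡c = solve-∀

lower<upper : ∀ N → lower N < upper N
lower<upper N = subst (lower N <_) (sym (upper≡lower+gap N)) (p<p+q (lower N) (gap-pos N))

lower-increasing : ∀ N → lower N < lower (suc N)
lower-increasing N = begin-strict
  lower N                    <⟨ p<p+q (lower N) (p<q⇒0<q-p next<gap) ⟩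
  lower N + (gap N - next)   ≡⟨ solve 3 (λ l g h → l :+ (g :- h) := l :+ g :- h) refl (lower N) (gap N) next ⟩
  lower N + gap N - next     ≡⟨ cong (_- next) (sym (upper≡lower+gap N)) ⟩
  upper N - next             ≡⟨ sym (lower-suc N) ⟩
  lower (suc N)              ∎
  where
  open ≤-Reasoning
  next = ℤ.+ 4 / suc (suc (N ℕ.+ N) ℕ.+ suc (N ℕ.+ N))
  next<gap : next < gap N
  next<gap = /-<-cross 4 4 (suc (N ℕ.+ N) ℕ.+ suc (N ℕ.+ N)) ((N ℕ.+ N) ℕ.+ (N ℕ.+ N))
    (ℕ.*-monoʳ-< 4 (ℕ.s≤s (ℕ.s≤s (ℕ.+-monoʳ-≤ (N ℕ.+ N) (ℕ.n≤1+n _)))))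

two<lower-suc : ∀ N → two < lower (suc N)
two<lower-suc zero    = from-yes (two <? lower 1)
two<lower-suc (suc N) = <-trans (two<lower-suc N) (lower-increasing (suc N))

-- A difference in (0, lower N) lies in (0, π); one in (upper N, 2 lower N) lies in (π, 2π).
S2Arc-forward : ∀ N {a b} → a < b → b < a + lower N → S2Arc a b
S2Arc-forward N {a} {b} a<b b<a+L = ℤ.+ 0 , (0 , 0<d , 0<d) , (N , d<L , <-trans d<L L<U)
  where
  0<d : 0ℚ < b - a
  0<d = p<q⇒0<q-p a<b
  d<L : b - a < ι (ℤ.+ 1) * lower N
  d<L = subst (b - a <_) (sym (*-identityˡ (lower N))) (q<p+r⇒q-p<r b<a+L)
  L<U : ι (ℤ.+ 1) * lower N < ι (ℤ.+ 1) * upper N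
  L<U = subst₂ _<_ (sym (*-identityˡ (lower N))) (sym (*-identityˡ (upper N))) (lower<upper N)

S2Arc-backward : ∀ N {a b} → b + upper N < a → a < b + (lower N + lower N) → S2Arc a b
S2Arc-backward N {a} {b} b+U<a a<b+2L =
  ℤ.-[1+ 0 ] , (N , -2L<d , <-trans -2U<-2L -2L<d) , (N , <-trans d<-U -U<-L , d<-U)
  where
  L = lower N
  U = upper N
  d≡-e : b - a ≡ - (a - b)
  d≡-e = solve 2 (λ a b → b :- a := :- (a :- b)) refl a b
  -2* : ∀ z → ι ℤ.-[1+ 1 ] * z ≡ - (z + z)
  -2* = solve 1 (λ z → (:- (con 1ℚ :+ con 1ℚ)) :* z := :- (z :+ z)) refl
  -1* : ∀ z → ι ℤ.-[1+ 0 ] * z ≡ - z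
  -1* = solve 1 (λ z → (:- con 1ℚ) :* z := :- z) refl
  -2L<d : ι ℤ.-[1+ 1 ] * L < b - a
  -2L<d = subst₂ _<_ (sym (-2* L)) (sym d≡-e) (neg-antimono-< (q<p+r⇒q-p<r a<b+2L))
  -2U<-2L : ι ℤ.-[1+ 1 ] * U < ι ℤ.-[1+ 1 ] * L
  -2U<-2L = subst₂ _<_ (sym (-2* U)) (sym (-2* L))
              (neg-antimono-< (+-mono-< (lower<upper N) (lower<upper N)))
  d<-U : b - a < ι ℤ.-[1+ 0 ] * U
  d<-U = subst₂ _<_ (sym d≡-e) (sym (-1* U)) (neg-antimono-< (p+q<r⇒q<r-p b+U<a))
  -U<-L : ι ℤ.-[1+ 0 ] * U < ι ℤ.-[1+ 0 ] * L
  -U<-L = subst₂ _<_ (sym (-1* U)) (sym (-1* L)) (neg-antimono-< (lower<upper N))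

S2Arc-shift : ∀ u {a b} → S2Arc a b → S2Arc (u + a) (u + b)
S2Arc-shift u {a} {b} = subst (λ d → ∃ λ k → (ℤ.+ 2 ℤ.* k) π·< d × d <π· (ℤ.+ 2 ℤ.* k ℤ.+ ℤ.+ 1))
  (solve 3 (λ u a b → b :- a := u :+ b :- (u :+ a)) refl u a b)

≢∧≢⇒≡ : ∀ {x y c : Fin 2} → x ≢ c → y ≢ c → x ≡ y
≢∧≢⇒≡ {zero}     {zero}                _   _   = refl
≢∧≢⇒≡ {suc zero} {suc zero}            _   _   = refl
≢∧≢⇒≡ {zero}     {suc zero} {zero}     x≢c _   = contradiction refl x≢c
≢∧≢⇒≡ {zero}     {suc zero} {suc zero} _   y≢c = contradiction refl y≢c
≢∧≢⇒≡ {suc zero} {zero}     {zero}     _   y≢c = contradiction refl y≢c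
≢∧≢⇒≡ {suc zero} {zero}     {suc zero} x≢c _   = contradiction refl x≢c

module ExtensionProperties {A : Set} {arc _≺_ : Rel A 0ℓ} {col : A → Fin 2}
                           (ext : IsExtension arc _≺_ col) where
  open IsStrictTotalOrder (proj₁ ext) using (irrefl) renaming (trans to ≺-trans)

  arc∧≡⇒≺ : ∀ {a b} → arc a b → col a ≡ col b → a ≺ b
  arc∧≡⇒≺ {a} {b} ab ≡col with Equivalence.to (proj₂ ext a b) ab
  ... | inj₁ (_ , a≺b)  = a≺b
  ... | inj₂ (≢col , _) = contradiction ≡col ≢col

  arc∧≢⇒≻ : ∀ {a b} → arc a b → col a ≢ col b → b ≺ a
  arc∧≢⇒≻ {a} {b} ab ≢col with Equivalence.to (proj₂ ext a b) ab
  ... | inj₁ (≡col , _) = contradiction ≡col ≢col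
  ... | inj₂ (_ , b≺a)  = b≺a

  transitive-triple-colour : ∀ {a b c} → arc a b → arc b c → arc a c →
                             col a ≡ col c → col b ≡ col a
  transitive-triple-colour {a} {b} {c} ab bc ac a≡c with col b Fin.≟ col a
  ... | yes b≡a = b≡a
  ... | no  b≢a = contradiction
    (≺-trans (arc∧≡⇒≺ ac a≡c) (≺-trans (arc∧≢⇒≻ bc (λ b≡c → b≢a (trans b≡c (sym a≡c))))
                                        (arc∧≢⇒≻ ab (b≢a ∘ sym))))
    (irrefl refl)

  cycle-not-monochromatic : ∀ {a b c} → arc a b → arc b c → arc c a →
                            col a ≡ col b → col b ≢ col c
  cycle-not-monochromatic ab bc ca a≡b b≡c = irrefl refl
    (≺-trans (arc∧≡⇒≺ ab a≡b) (≺-trans (arc∧≡⇒≺ bc b≡c) (arc∧≡⇒≺ ca (sym (trans a≡b b≡c)))))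

module Rank {n : ℕ} {_≺_ : Rel (Fin n) 0ℓ} (sto : IsStrictTotalOrder _≡_ _≺_) where
  open IsStrictTotalOrder sto using (irrefl) renaming (_<?_ to _≺?_; trans to ≺-trans)

  below : Fin n → Subset n
  below a = tabulate (λ c → does (c ≺? a))

  ≺⇒∈below : ∀ {a c} → c ≺ a → c ∈ below a
  ≺⇒∈below {a} {c} c≺a =
    lookup⇒[]= c (below a) (trans (lookup∘tabulate _ c) (dec-true (c ≺? a) c≺a))

  ∈below⇒≺ : ∀ {a c} → c ∈ below a → c ≺ a
  ∈below⇒≺ {a} {c} c∈ with c ≺? a | trans (sym (lookup∘tabulate _ c)) ([]=⇒lookup c∈)
  ... | yes c≺a | _ = c≺a

  ∉below : ∀ a → a ∉ below a
  ∉below a a∈ = irrefl refl (∈below⇒≺ a∈)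

  rank : Fin n → ℕ
  rank a = ∣ below a ∣

  rank-mono : ∀ {a b} → a ≺ b → rank a ℕ.< rank b
  rank-mono {a} {b} a≺b =
    p⊂q⇒∣p∣<∣q∣ ((λ c∈ → ≺⇒∈below (≺-trans (∈below⇒≺ c∈) a≺b)) , a , ≺⇒∈below a≺b , ∉below a)

  rank<n : ∀ a → rank a ℕ.< n
  rank<n a = subst (rank a ℕ.<_) (∣⊤∣≡n n) (p⊂q⇒∣p∣<∣q∣ ((λ _ → ∈⊤) , a , ∈⊤ , ∉below a))

strictMono⇒injective : ∀ {A B : Set} {_<₁_ : Rel A 0ℓ} {_<₂_ : Rel B 0ℓ} →
  IsStrictTotalOrder _≡_ _<₁_ → Irreflexive _≡_ _<₂_ →
  {f : A → B} → (∀ a b → a <₁ b → f a <₂ f b) → Injective _≡_ _≡_ f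
strictMono⇒injective sto irrefl₂ mono {a} {b} fa≡fb with IsStrictTotalOrder.compare sto a b
... | tri< a<b _ _ = contradiction (mono _ _ a<b) (irrefl₂ fa≡fb)
... | tri≈ _ a≡b _ = a≡b
... | tri> _ _ b<a = contradiction (mono _ _ b<a) (irrefl₂ (sym fa≡fb))

module S2Extension {_≺_ : Rel ℚ 0ℓ} {col : ℚ → Fin 2} (ext : IsExtension S2Arc _≺_ col) where
  open ExtensionProperties ext

  monochromatic-unit-step : ∃ λ u → col u ≡ col (u + 1ℚ)
  monochromatic-unit-step with col 0ℚ Fin.≟ col 1ℚ | col 1ℚ Fin.≟ col two
  ... | yes 0≡1 | _       = 0ℚ , 0≡1
  ... | no  _   | yes 1≡2 = 1ℚ , 1≡2
  ... | no  0≢1 | no  1≢2 = contradiction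
    (transitive-triple-colour (arc 0ℚ 1ℚ _ _) (arc 1ℚ two _ _) (arc 0ℚ two _ _)
                              (≢∧≢⇒≡ 0≢1 (1≢2 ∘ sym)))
    (0≢1 ∘ sym)
    where
    arc : ∀ a b → True (a <? b) → True (b <? a + lower 1) → S2Arc a b
    arc a b a<b b<a+L = S2Arc-forward 1 (toWitness a<b) (toWitness b<a+L)

  -- Points are written u + offset throughout, so that S2Arc-shift applies; u itself is u + 0ℚ.
  module Windows (u : ℚ) (unit-step : col u ≡ col (u + 1ℚ)) (N : ℕ) where
    L ε : ℚ
    L = lower (suc N)
    ε = gap (suc N)

    1<L : 1ℚ < L
    1<L = <-trans (from-yes (1ℚ <? two)) (two<lower-suc N)

    0<1 : 0ℚ < 1ℚ
    0<1 = from-yes (0ℚ <? 1ℚ)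

    u+0≡u : col (u + 0ℚ) ≡ col u
    u+0≡u = cong col (+-identityʳ u)

    arc-forward : ∀ {a b} → a < b → b < a + L → S2Arc (u + a) (u + b)
    arc-forward a<b b<a+L = S2Arc-shift u (S2Arc-forward (suc N) a<b b<a+L)

    arc-backward : ∀ {a b} → (b + ε) + L < a → a < (b + L) + L → S2Arc (u + a) (u + b)
    arc-backward {a} {b} b+ε+L<a a<b+L+L = S2Arc-shift u (S2Arc-backward (suc N) {a} {b}
      (subst (_< a) b+ε+L≡b+U b+ε+L<a) (subst (a <_) (+-assoc b L L) a<b+L+L))
      where
      b+ε+L≡b+U : (b + ε) + L ≡ b + upper (suc N)
      b+ε+L≡b+U = trans (solve 3 (λ b e l → (b :+ e) :+ l := b :+ (l :+ e)) refl b ε L)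
                        (cong (b +_) (sym (upper≡lower+gap (suc N))))

    near-colour : ∀ {s} → 0ℚ < s → s < 1ℚ → col (u + s) ≡ col u
    near-colour 0<s s<1 = trans (transitive-triple-colour
      (arc-forward 0<s (p<r⇒p<q+r (<-trans s<1 1<L) ≤-refl))
      (arc-forward s<1 (p<r⇒p<q+r 1<L (<⇒≤ 0<s)))
      (arc-forward 0<1 (p<r⇒p<q+r 1<L ≤-refl))
      (trans u+0≡u unit-step)) u+0≡u

    far-colour : ∀ {s} → ε < s → s < 1ℚ → col (u + (s + L)) ≢ col u
    far-colour {s} ε<s s<1 far≡u = cycle-not-monochromatic
      (arc-forward 0<1 (p<r⇒p<q+r 1<L ≤-refl))
      (arc-forward (p<r⇒p<q+r 1<L (<⇒≤ (<-trans (gap-pos (suc N)) ε<s))) (+-monoˡ-< L s<1))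
      (arc-backward (+-monoˡ-< L (subst (_< s) (sym (+-identityˡ ε)) ε<s))
                    (+-monoˡ-< L (p<r⇒p<q+r (<-trans s<1 1<L) ≤-refl)))
      (trans u+0≡u unit-step) (trans (sym unit-step) (sym far≡u))

    place : ∀ {c} → Dec (c ≡ col u) → ℚ → ℚ
    place (yes _) s = s
    place (no  _) s = s + L

    colour-place : ∀ {c} (c≟ : Dec (c ≡ col u)) {s} → ε < s → s < 1ℚ → col (u + place c≟ s) ≡ c
    colour-place (yes c≡u) ε<s s<1 = trans (near-colour (<-trans (gap-pos (suc N)) ε<s) s<1) (sym c≡u)
    colour-place (no  c≢u) ε<s s<1 = ≢∧≢⇒≡ (far-colour ε<s s<1) c≢u

    place-≺ : ∀ {c c'} (c≟ : Dec (c ≡ col u)) (c'≟ : Dec (c' ≡ col u)) {s s'} →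
              ε < s → s + ε < s' → s' < 1ℚ → (u + place c≟ s) ≺ (u + place c'≟ s')
    place-≺ c≟ c'≟ {s} {s'} ε<s s+ε<s' s'<1 = by-windows c≟ c'≟
      where
      0<s = <-trans (gap-pos (suc N)) ε<s
      s<s' = <-trans (p<p+q s (gap-pos (suc N))) s+ε<s'
      s'<s+L = p<r⇒p<q+r (<-trans s'<1 1<L) (<⇒≤ 0<s)
      near-s = near-colour 0<s (<-trans s<s' s'<1)
      near-s' = near-colour (<-trans 0<s s<s') s'<1
      far-s = far-colour ε<s (<-trans s<s' s'<1)
      far-s' = far-colour (<-trans ε<s s<s') s'<1
      by-windows : ∀ {c c'} (c≟ : Dec (c ≡ col u)) (c'≟ : Dec (c' ≡ col u)) →
                   (u + place c≟ s) ≺ (u + place c'≟ s')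
      by-windows (yes _) (yes _) =
        arc∧≡⇒≺ (arc-forward s<s' s'<s+L) (trans near-s (sym near-s'))
      by-windows (no _) (no _) =
        arc∧≡⇒≺ (arc-forward (+-monoˡ-< L s<s') (+-monoˡ-< L s'<s+L)) (≢∧≢⇒≡ far-s far-s')
      by-windows (yes _) (no _) =
        arc∧≢⇒≻ (arc-backward (+-monoˡ-< L s+ε<s') (+-monoˡ-< L s'<s+L))
                (λ far≡near → far-s' (trans far≡near near-s))
      by-windows (no _) (yes _) =
        arc∧≢⇒≻ (arc-forward s'<s+L (+-monoˡ-< L s<s'))
                (λ near≡far → far-s (trans (sym near≡far) near-s'))

slot : ℕ → ℕ → ℚ
slot n i = ℤ.+ suc i / suc n

gap<slot : ∀ n i → gap (suc n) < slot n i
gap<slot n i = <-≤-trans (gap<1/suc n)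
  (/-≤-cross 1 (suc i) n n (ℕ.*-monoˡ-≤ (suc n) (ℕ.s≤s {n = i} ℕ.z≤n)))

slot+gap<slot : ∀ n {i j} → i ℕ.< j → slot n i + gap (suc n) < slot n j
slot+gap<slot n {i} {j} i<j = begin-strict
  slot n i + gap (suc n)     <⟨ +-monoʳ-< (slot n i) (gap<1/suc n) ⟩
  slot n i + ℤ.+ 1 / suc n   ≡⟨ sym (/-distribʳ-+ (ℤ.+ suc i) (ℤ.+ 1) n) ⟩
  ℤ.+ (suc i ℕ.+ 1) / suc n  ≤⟨ /-≤-cross (suc i ℕ.+ 1) (suc j) n n (ℕ.*-monoˡ-≤ (suc n) i+2≤j+1) ⟩
  slot n j                   ∎
  where
  open ≤-Reasoning
  i+2≤j+1 : suc i ℕ.+ 1 ℕ.≤ suc j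
  i+2≤j+1 = subst (ℕ._≤ suc j) (ℕ.+-comm 1 (suc i)) (ℕ.s≤s i<j)

slot<1 : ∀ {n i} → i ℕ.< n → slot n i < 1ℚ
slot<1 {n} {i} i<n = /-<-cross (suc i) 1 n 0
  (subst₂ ℕ._<_ (sym (ℕ.*-identityʳ (suc i))) (sym (ℕ.*-identityˡ (suc n))) (ℕ.s≤s i<n))

lemma4p2 : (n : ℕ) (X : Rel (Fin n) 0ℓ) → InC n X →
    (<X : Rel (Fin n) 0ℓ) (cX : Fin n → Fin 2) → IsExtension X <X cX →
    (<S : Rel ℚ 0ℓ) (cS : ℚ → Fin 2) → IsExtension S2Arc <S cS →
    Embeds <X cX <S cS
lemma4p2 n X _ <X cX extX <S cS extS =
  f , strictMono⇒injective (proj₁ extX) (IsStrictTotalOrder.irrefl (proj₁ extS)) f-mono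
    , f-mono , f-colour
  where
  open S2Extension extS
  u = proj₁ monochromatic-unit-step
  open Windows u (proj₂ monochromatic-unit-step) n
  open Rank (proj₁ extX)

  window : ∀ a → Dec (cX a ≡ cS u)
  window a = cX a Fin.≟ cS u

  f : Fin n → ℚ
  f a = u + place (window a) (slot n (rank a))

  f-mono : ∀ a b → <X a b → <S (f a) (f b)
  f-mono a b a<b = place-≺ (window a) (window b)
    (gap<slot n (rank a)) (slot+gap<slot n (rank-mono a<b)) (slot<1 (rank<n b))

  f-colour : ∀ a → cS (f a) ≡ cX a
  f-colour a = colour-place (window a) (gap<slot n (rank a)) (slot<1 (rank<n a))
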